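{- Let $\mathsf{CS}$ be an axiomatically appropriate constant specification for $\mathsf{JEM}$. For every formula $F$: $\mathsf{JEM}_{\mathsf{CS}}\vdash F$ if and only if $\mathcal M\Vdash F$ for every fully explanatory $\mathsf{JEM}_{\mathsf{CS}}$ monotonic modular model $\mathcal M$.
   Context: Language. Fix countably many proof constants $\alpha_i$, proof variables $\xi_i$, justification variables $x_i$, and a countable set $\mathsf{Prop}$ of atomic propositions. Proof terms: $\lambda ::= \alpha_i \mid \xi_i \mid (\lambda\cdot\lambda) \mid\ !\lambda$ (set $\mathsf{PTm}$). Justification terms: $t ::= x_i \mid t+t \mid \mathsf{m}(\lambda,t)$, $\lambda\in\mathsf{PTm}$ (set $\mathsf{JTm}$). Formulas: $F ::= P\mid\bot\mid(F\to F)\mid\lambda:F\mid[t]F$ (set $\mathsf{Fm}$); other connectives are classical abbreviations. Axioms of $\mathsf{JEM}$: all instances of classical propositional tautologies and of (j) $\lambda:(F\to G)\to(\kappa:F\to\lambda\cdot\kappa:G)$; (jt) $\lambda:F\to F$; (j4) $\lambda:F\to\ !\lambda:\lambda:F$; (jm) $\lambda:(F\to G)\to([t]F\to[\mathsf{m}(\lambda,t)]G)$; (j+$_2$) $([t]F\vee[s]F)\to[t+s]F$. A constant specification $\mathsf{CS}$ is a set of pairs $(\alpha,A)$, $\alpha$ a proof constant, $A$ an axiom of $\mathsf{JEM}$; it is axiomatically appropriate if every axiom $A$ of $\mathsf{JEM}$ has some constant $\alpha$ with $(\alpha,A)\in\mathsf{CS}$. $\mathsf{JEM}_{\mathsf{CS}}$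 is the Hilbert system with these axioms, modus ponens, and axiom necessitation (infer $\alpha:A$ whenever $(\alpha,A)\in\mathsf{CS}$). Basic evaluations. For sets of formulas $X,Y$: $\lambda:X=\{\lambda:F\mid F\in X\}$; $X\cdot Y=\{F\mid G\to F\in X\text{ for some }G\in Y\}$. A basic evaluation for $\mathsf{JEM}_{\mathsf{CS}}$ is a map $\varepsilon$ with $\varepsilon(P)\in\{0,1\}$ and $\varepsilon:\mathsf{PTm}\cup\mathsf{JTm}\to\mathcal P(\mathsf{Fm})$ such that for all $\lambda,\kappa\in\mathsf{PTm}$, $t,s\in\mathsf{JTm}$: $\varepsilon(\lambda)\cdot\varepsilon(\kappa)\subseteq\varepsilon(\lambda\cdot\kappa)$; $F\in\varepsilon(\lambda)$ if $(\lambda,F)\in\mathsf{CS}$; $\lambda:\varepsilon(\lambda)\subseteq\varepsilon(!\lambda)$; $\varepsilon(\lambda)\cdot\varepsilon(t)\subseteq\varepsilon(\mathsf{m}(\lambda,t))$; $\varepsilon(t)\cup\varepsilon(s)\subseteq\varepsilon(t+s)$. Models. $N:W\to\mathcal P(\mathcal P(W))$ is monotonic if $X\in N(w)$ and $X\subseteq Y\subseteq W$ imply $Y\in N(w)$. A monotonic quasi-model is $\mathcal M=\langle W,N,\varepsilon\rangle$ with $W\neq\emptyset$, $N$ monotonic, and $\varepsilon$ assigning to each $w$ a basic evaluation $\varepsilon_w$ for $\mathsf{JEM}_{\mathsf{CS}}$. Truth: $\mathcal M,w\nVdash\bot$; $\mathcal M,w\Vdash P$ iff $\varepsilon_w(P)=1$;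 $\to$ classical; $\mathcal M,w\Vdash\lambda:F$ iff $F\in\varepsilon_w(\lambda)$; $\mathcal M,w\Vdash[t]F$ iff $F\in\varepsilon_w(t)$. $\mathcal M\Vdash F$ means truth at every world; $|F|^{\mathcal M}=\{w\mid\mathcal M,w\Vdash F\}$. A monotonic modular model is a monotonic quasi-model that is factive ($\mathcal M,w\Vdash\lambda:F$ implies $\mathcal M,w\Vdash F$) and satisfies: for all $t\in\mathsf{JTm}$, $w$, $F$, if $F\in\varepsilon_w(t)$ then $|F|^{\mathcal M}\in N(w)$. It is fully explanatory if for all $w\in W$ and formulas $F$, $|F|^{\mathcal M}\in N(w)$ implies $F\in\varepsilon_w(t)$ for some $t\in\mathsf{JTm}$. -}

module Defs where

open import Data.Nat using (ℕ)
open import Data.Bool using (Bool; true; false; not; _∨_)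
open import Data.Product using (Σ; ∃; _×_; _,_)
open import Data.Sum using (_⊎_)
open import Relation.Binary.PropositionalEquality using (_≡_)
open import Level using (Level; suc; _⊔_)

data PTm : Set where
  pc   : ℕ → PTm
  pv   : ℕ → PTm
  _·_  : PTm → PTm → PTm
  !_   : PTm → PTm

data JTm : Set where
  jv   : ℕ → JTm
  _⊕_  : JTm → JTm → JTm
  m    : PTm → JTm → JTm

infixr 5 _⇒_
data Fm : Set where
  atom : ℕ → Fm
  ⊥'   : Fm
  _⇒_  : Fm → Fm → Fm
  _∶_  : PTm → Fm → Fm
  [_]_ : JTm → Fm → Fm

¬' : Fm → Fm
¬' F = F ⇒ ⊥'

_∨'_ : Fm → Fm → Fm
F ∨' G = ¬' F ⇒ G

-- Instances of classical propositional tautologies: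
-- formulas true under every Boolean valuation in which the
-- "propositional atoms" are the atomic propositions and the formulas
-- of the shape λ:F and [t]F.

tv : (Fm → Bool) → Fm → Bool
tv v (atom p)  = v (atom p)
tv v ⊥'        = false
tv v (F ⇒ G)   = not (tv v F) ∨ tv v G
tv v (λ' ∶ F)  = v (λ' ∶ F)
tv v ([ t ] F) = v ([ t ] F)

Tautology : Fm → Set
Tautology F = (v : Fm → Bool) → tv v F ≡ true

data Axiom : Fm → Set where
  ax-taut : ∀ {F} → Tautology F → Axiom F
  ax-j    : ∀ (l k : PTm) (F G : Fm) →
            Axiom ((l ∶ (F ⇒ G)) ⇒ ((k ∶ F) ⇒ ((l · k) ∶ G)))
  ax-jt   : ∀ (l : PTm) (F : Fm) → Axiom ((l ∶ F) ⇒ F)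
  ax-j4   : ∀ (l : PTm) (F : Fm) → Axiom ((l ∶ F) ⇒ ((! l) ∶ (l ∶ F)))
  ax-jm   : ∀ (l : PTm) (t : JTm) (F G : Fm) →
            Axiom ((l ∶ (F ⇒ G)) ⇒ (([ t ] F) ⇒ ([ m l t ] G)))
  ax-j+   : ∀ (t s : JTm) (F : Fm) →
            Axiom ((([ t ] F) ∨' ([ s ] F)) ⇒ ([ t ⊕ s ] F))

record ConstSpec : Set₁ where
  field
    _∈CS_   : ℕ → Fm → Set
    onlyAx  : ∀ {i A} → i ∈CS A → Axiom A
open ConstSpec public

AxiomaticallyAppropriate : ConstSpec → Set
AxiomaticallyAppropriate CS = ∀ A → Axiom A → ∃ λ i → _∈CS_ CS i A

data _⊢_ (CS : ConstSpec) : Fm → Set where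
  axm : ∀ {A} → Axiom A → CS ⊢ A
  mp  : ∀ {F G} → CS ⊢ (F ⇒ G) → CS ⊢ F → CS ⊢ G
  an  : ∀ {i A} → _∈CS_ CS i A → CS ⊢ (pc i ∶ A)

-- Basic evaluations (sets of formulas are represented as Fm → Bool)

_∈ᵇ_ : Fm → (Fm → Bool) → Set
F ∈ᵇ X = X F ≡ true

record BasicEval (CS : ConstSpec) : Set where
  field
    val  : ℕ → Bool
    εp   : PTm → Fm → Bool
    εj   : JTm → Fm → Bool
    app  : ∀ l k F G → (G ⇒ F) ∈ᵇ εp l → G ∈ᵇ εp k → F ∈ᵇ εp (l · k)
    cs   : ∀ i F → _∈CS_ CS i F → F ∈ᵇ εp (pc i)
    bang : ∀ l F → F ∈ᵇ εp l → (l ∶ F) ∈ᵇ εp (! l)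
    mj   : ∀ l t F G → (G ⇒ F) ∈ᵇ εp l → G ∈ᵇ εj t → F ∈ᵇ εj (m l t)
    plusˡ : ∀ t s F → F ∈ᵇ εj t → F ∈ᵇ εj (t ⊕ s)
    plusʳ : ∀ t s F → F ∈ᵇ εj s → F ∈ᵇ εj (t ⊕ s)
open BasicEval public

-- Monotonic quasi-models (subsets of W represented as W → Bool)

_⊆ʷ_ : {W : Set} → (W → Bool) → (W → Bool) → Set
X ⊆ʷ Y = ∀ w → X w ≡ true → Y w ≡ true

record QuasiModel (CS : ConstSpec) : Set₁ where
  field
    W    : Set
    w₀   : W                                    -- W ≠ ∅
    N    : W → (W → Bool) → Set
    mono : ∀ w X Y → N w X → X ⊆ʷ Y → N w Y
    ε    : W → BasicEval CS

  sat : W → Fm → Bool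
  sat w (atom p)   = val (ε w) p
  sat w ⊥'         = false
  sat w (F ⇒ G)    = not (sat w F) ∨ sat w G
  sat w (l ∶ F)    = εp (ε w) l F
  sat w ([ t ] F)  = εj (ε w) t F

  _⊩_ : W → Fm → Set
  w ⊩ F = sat w F ≡ true

  ext : Fm → W → Bool
  ext F w = sat w F

  Valid : Fm → Set
  Valid F = ∀ w → w ⊩ F

  Factive : Set
  Factive = ∀ w l F → w ⊩ (l ∶ F) → w ⊩ F

  JustNbhd : Set
  JustNbhd = ∀ (t : JTm) w F → F ∈ᵇ εj (ε w) t → N w (ext F)

  FullyExplanatory : Set
  FullyExplanatory = ∀ w F → N w (ext F) → ∃ λ (t : JTm) → F ∈ᵇ εj (ε w) t
open QuasiModel public

ModularModel : (CS : ConstSpec) → QuasiModel CS → Set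
ModularModel CS M = Factive M × JustNbhd M

{-# OPTIONS --safe #-}
-- Soundness is checked axiom by axiom and uses only factivity.  For completeness, the
-- canonical model has the maximal consistent sets as worlds (Lindenbaum's construction
-- along an enumeration of the formulas, deciding consistency by excluded middle), reads
-- the basic evaluations off membership, and lets N(w) be the upward closure of the truth
-- sets |G| with [t]G ∈ w.  It is fully explanatory: if |G| ⊆ |F| and [t]G ∈ w, then
-- G → F lies in every maximal consistent set and is therefore a theorem; internalization
-- turns it into a theorem λ:(G → F), and (jm) puts [m(λ,t)]F into w.
module Submission where

open import Defs
open import Data.Product using (_×_)
open import Axiom.ExcludedMiddle using (ExcludedMiddle)
open import Level using (0ℓ)

open import Axiom.DoubleNegationElimination using (em⇒dne)
open import Data.Bool using (Bool; true; false; not; _∨_)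
open import Data.Bool.Properties using (¬-not; not-¬)
open import Data.Empty using (⊥-elim)
open import Data.List using (List; []; _∷_; _++_; _∷ʳ_; map; foldr; cartesianProductWith)
open import Data.List.Properties using (foldr-∷ʳ)
open import Data.List.Membership.Propositional using (_∈_)
open import Data.List.Membership.Propositional.Properties
  using (∈-++⁺ˡ; ∈-++⁺ʳ; ∈-map⁺; ∈-cartesianProductWith⁺)
open import Data.List.Relation.Binary.Subset.Propositional using (_⊆_)
open import Data.List.Relation.Unary.All as All using (All; []; _∷_)
open import Data.List.Relation.Unary.All.Properties using (∷ʳ⁻)
open import Data.List.Relation.Unary.Any using (here; there)
open import Data.Nat using (ℕ; zero; suc; _≤_; _≤′_; ≤′-reflexive; ≤′-step; _⊔_)
open import Data.Nat.Properties using (≤⇒≤′; m≤m⊔n; m≤n⊔m)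
open import Data.Product using (Σ; ∃; ∃₂; _,_)
open import Data.Sum using (_⊎_; inj₁; inj₂; [_,_]′)
open import Relation.Binary.PropositionalEquality using (_≡_; refl; sym; trans; cong₂; subst)
open import Relation.Nullary using (¬_; Dec; yes; no; does)
open import Relation.Nullary.Decidable using (dec-true)

private
  variable
    A B F G : Fm
    L L′ : List Fm
    t : JTm

⇒ᵇ-intro : ∀ {a b} → (a ≡ true → b ≡ true) → not a ∨ b ≡ true
⇒ᵇ-intro {false} _ = refl
⇒ᵇ-intro {true}  f = f refl

⇒ᵇ-elim : ∀ {a b} → not a ∨ b ≡ true → a ≡ true → b ≡ true
⇒ᵇ-elim h refl = h

∨ᵇ-elim : ∀ {a b} → not (not a ∨ false) ∨ b ≡ true → a ≡ true ⊎ b ≡ true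
∨ᵇ-elim {true}  _ = inj₁ refl
∨ᵇ-elim {false} h = inj₂ h

witness : {P : Set} (P? : Dec P) → does P? ≡ true → P
witness (yes p) _ = p

_⊨_ : (Fm → Bool) → Fm → Set
v ⊨ F = tv v F ≡ true

_⇒*_ : List Fm → Fm → Fm
L ⇒* G = foldr _⇒_ G L

⇒*-∷ʳ : ∀ L A B → (L ∷ʳ A) ⇒* B ≡ L ⇒* (A ⇒ B)
⇒*-∷ʳ L A B = foldr-∷ʳ _⇒_ B A L

⇒*-elim : ∀ v L G → v ⊨ (L ⇒* G) → All (v ⊨_) L → v ⊨ G
⇒*-elim v []      G h []       = h
⇒*-elim v (_ ∷ L) G h (a ∷ as) = ⇒*-elim v L G (⇒ᵇ-elim h a) as

⇒*-intro : ∀ v L G → (All (v ⊨_) L → v ⊨ G) → v ⊨ (L ⇒* G)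
⇒*-intro v []      G f = f []
⇒*-intro v (_ ∷ L) G f = ⇒ᵇ-intro λ a → ⇒*-intro v L G (λ as → f (a ∷ as))

weakening-taut : ∀ A B → Tautology (A ⇒ (B ⇒ A))
weakening-taut A B v = ⇒ᵇ-intro {tv v A} λ a → ⇒ᵇ-intro {tv v B} λ _ → a

explosion-taut : ∀ A B → Tautology (¬' A ⇒ (A ⇒ B))
explosion-taut A B v with tv v A
... | true  = refl
... | false = refl

∨'-introˡ-taut : ∀ A B → Tautology (A ⇒ (A ∨' B))
∨'-introˡ-taut A B v with tv v A
... | true  = refl
... | false = refl

dne-taut : ∀ A → Tautology (¬' (¬' A) ⇒ A)
dne-taut A v with tv v A
... | true  = refl
... | false = refl

-- Soundness

module _ {CS : ConstSpec} (M : QuasiModel CS) where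

  sat-tv : ∀ w F → sat M w F ≡ tv (sat M w) F
  sat-tv w (atom p)  = refl
  sat-tv w ⊥'        = refl
  sat-tv w (F ⇒ G)   = cong₂ (λ a b → not a ∨ b) (sat-tv w F) (sat-tv w G)
  sat-tv w (l ∶ F)   = refl
  sat-tv w ([ t ] F) = refl

  axiom-valid : Factive M → Axiom A → Valid M A
  axiom-valid {A} _ (ax-taut τ) w = trans (sat-tv w A) (τ (sat M w))
  axiom-valid _ (ax-j l k F G) w =
    ⇒ᵇ-intro λ l∶F⇒G → ⇒ᵇ-intro λ k∶F → app (ε M w) l k G F l∶F⇒G k∶F
  axiom-valid factive (ax-jt l F) w = ⇒ᵇ-intro (factive w l F)
  axiom-valid _ (ax-j4 l F) w = ⇒ᵇ-intro (bang (ε M w) l F)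
  axiom-valid _ (ax-jm l t F G) w =
    ⇒ᵇ-intro λ l∶F⇒G → ⇒ᵇ-intro λ tF → mj (ε M w) l t G F l∶F⇒G tF
  axiom-valid _ (ax-j+ t s F) w = ⇒ᵇ-intro λ h → [ plusˡ (ε M w) t s F , plusʳ (ε M w) t s F ]′ (∨ᵇ-elim h)

  soundness : Factive M → CS ⊢ A → Valid M A
  soundness factive (axm ax)        w = axiom-valid factive ax w
  soundness factive (mp d e)        w = ⇒ᵇ-elim (soundness factive d w) (soundness factive e w)
  soundness _       (an {i} {A} c) w = cs (ε M w) i A c

module Derivations (CS : ConstSpec) where

  -- A record rather than a synonym for CS ⊢ (L ⇒* G), so that L and G are inferable.
  record _⊢*_ (L : List Fm) (G : Fm) : Set where
    constructor mk⊢*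
    field ⇒*-derivable : CS ⊢ (L ⇒* G)
  open _⊢*_ public

  Consistent : List Fm → Set
  Consistent L = ¬ (L ⊢* ⊥')

  ⊢-taut : Tautology (A ⇒ B) → CS ⊢ A → CS ⊢ B
  ⊢-taut τ = mp (axm (ax-taut τ))

  ⊢*-assumption : G ∈ L → L ⊢* G
  ⊢*-assumption {G} {L} G∈L = mk⊢* (axm (ax-taut λ v → ⇒*-intro v L G (λ hs → All.lookup hs G∈L)))

  ⊢*-weaken : L ⊆ L′ → L ⊢* G → L′ ⊢* G
  ⊢*-weaken {L} {L′} {G} L⊆L′ (mk⊢* d) = mk⊢* (⊢-taut τ d)
    where
    τ : Tautology ((L ⇒* G) ⇒ (L′ ⇒* G))
    τ v = ⇒ᵇ-intro λ h → ⇒*-intro v L′ G λ hs →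
      ⇒*-elim v L G h (All.tabulate (λ x∈L → All.lookup hs (L⊆L′ x∈L)))

  ⊢*-taut : Tautology (A ⇒ B) → L ⊢* A → L ⊢* B
  ⊢*-taut {A} {B} {L} τ (mk⊢* d) = mk⊢* (⊢-taut τ* d)
    where
    τ* : Tautology ((L ⇒* A) ⇒ (L ⇒* B))
    τ* v = ⇒ᵇ-intro λ h → ⇒*-intro v L B λ hs → ⇒ᵇ-elim (τ v) (⇒*-elim v L A h hs)

  ⊢*-mp : L ⊢* (A ⇒ B) → L ⊢* A → L ⊢* B
  ⊢*-mp {L} {A} {B} (mk⊢* d) (mk⊢* e) = mk⊢* (mp (⊢-taut τ d) e)
    where
    τ : Tautology ((L ⇒* (A ⇒ B)) ⇒ ((L ⇒* A) ⇒ (L ⇒* B)))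
    τ v = ⇒ᵇ-intro λ f → ⇒ᵇ-intro λ a → ⇒*-intro v L B λ hs →
      ⇒ᵇ-elim (⇒*-elim v L (A ⇒ B) f hs) (⇒*-elim v L A a hs)

  deduction : (L ∷ʳ A) ⊢* B → L ⊢* (A ⇒ B)
  deduction {L} {A} {B} (mk⊢* d) = mk⊢* (subst (CS ⊢_) (⇒*-∷ʳ L A B) d)

  internalization : AxiomaticallyAppropriate CS → CS ⊢ A → ∃ λ l → CS ⊢ (l ∶ A)
  internalization {A} AA (axm ax) with AA A ax
  ... | i , c = pc i , an c
  internalization AA (mp {F} {G} d e) with internalization AA d | internalization AA e
  ... | l , ⊢l | k , ⊢k = l · k , mp (mp (axm (ax-j l k F G)) ⊢l) ⊢k
  internalization AA (an {i} {A} c) = ! pc i , mp (axm (ax-j4 (pc i) A)) (an c)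

record MaxConsistent (CS : ConstSpec) : Set where
  field
    mem        : Fm → Bool
    ⊢⇒∈        : ∀ {A} → CS ⊢ A → A ∈ᵇ mem
    ∈-mp       : ∀ {A B} → (A ⇒ B) ∈ᵇ mem → A ∈ᵇ mem → B ∈ᵇ mem
    ⊥∉         : ¬ (⊥' ∈ᵇ mem)
    ∈-complete : ∀ A → A ∈ᵇ mem ⊎ ¬' A ∈ᵇ mem

  ∈-⊢⇒ : ∀ {A B} → CS ⊢ (A ⇒ B) → A ∈ᵇ mem → B ∈ᵇ mem
  ∈-⊢⇒ d = ∈-mp (⊢⇒∈ d)

  ∈-⊢⇒⇒ : ∀ {A B C} → CS ⊢ (A ⇒ (B ⇒ C)) → A ∈ᵇ mem → B ∈ᵇ mem → C ∈ᵇ mem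
  ∈-⊢⇒⇒ d a = ∈-mp (∈-⊢⇒ d a)

  ∉⇒¬∈ : ∀ {A} → mem A ≡ false → ¬' A ∈ᵇ mem
  ∉⇒¬∈ {A} A∉ with ∈-complete A
  ... | inj₁ A∈  = ⊥-elim (not-¬ A∈ A∉)
  ... | inj₂ ¬A∈ = ¬A∈

  mem-⇒ : ∀ F G → mem (F ⇒ G) ≡ not (mem F) ∨ mem G
  mem-⇒ F G with mem F in F∈ | mem G in G∈
  ... | false | _     = ∈-⊢⇒ (axm (ax-taut (explosion-taut F G))) (∉⇒¬∈ F∈)
  ... | true  | true  = ∈-⊢⇒ (axm (ax-taut (weakening-taut G F))) G∈
  ... | true  | false = ¬-not λ F⇒G∈ → not-¬ (∈-mp F⇒G∈ F∈) G∈

open MaxConsistent public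

-- Enumerating the formulas

module IncreasingChain {X : Set} (f : ℕ → List X) (f-step : ∀ n → f n ⊆ f (suc n)) where

  mono-≤ : ∀ {m n} → m ≤ n → f m ⊆ f n
  mono-≤ m≤n = go (≤⇒≤′ m≤n)
    where
    go : ∀ {m n} → m ≤′ n → f m ⊆ f n
    go (≤′-reflexive refl) = λ x∈ → x∈
    go (≤′-step m≤′n)      = λ x∈ → f-step _ (go m≤′n x∈)

  mono-⊔ˡ : ∀ a b → f a ⊆ f (a ⊔ b)
  mono-⊔ˡ a b = mono-≤ (m≤m⊔n a b)

  mono-⊔ʳ : ∀ a b → f b ⊆ f (a ⊔ b)
  mono-⊔ʳ a b = mono-≤ (m≤n⊔m a b)

  bound : ∀ {L} → All (λ x → ∃ λ n → x ∈ f n) L → ∃ λ n → L ⊆ f n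
  bound [] = 0 , λ ()
  bound ((a , x∈) ∷ rest) with bound rest
  ... | b , L⊆ = a ⊔ b , λ { (here refl) → mono-⊔ˡ a b x∈ ; (there y∈) → mono-⊔ʳ a b (L⊆ y∈) }

ptms : ℕ → List PTm
ptms zero    = []
ptms (suc n) = ptms n ++ (pc n ∷ pv n ∷ (cartesianProductWith _·_ (ptms n) (ptms n) ++ map !_ (ptms n)))

module PTms = IncreasingChain ptms (λ n → ∈-++⁺ˡ)

ptms-covers : ∀ l → ∃ λ n → l ∈ ptms n
ptms-covers (pc i) = suc i , ∈-++⁺ʳ (ptms i) (here refl)
ptms-covers (pv i) = suc i , ∈-++⁺ʳ (ptms i) (there (here refl))
ptms-covers (l · k) with ptms-covers l | ptms-covers k
... | a , l∈ | b , k∈ = suc (a ⊔ b) , ∈-++⁺ʳ (ptms (a ⊔ b)) (there (there (∈-++⁺ˡ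
      (∈-cartesianProductWith⁺ _·_ (PTms.mono-⊔ˡ a b l∈) (PTms.mono-⊔ʳ a b k∈)))))
ptms-covers (! l) with ptms-covers l
... | a , l∈ = suc a , ∈-++⁺ʳ (ptms a) (there (there
      (∈-++⁺ʳ (cartesianProductWith _·_ (ptms a) (ptms a)) (∈-map⁺ !_ l∈))))

jtms : ℕ → List JTm
jtms zero    = []
jtms (suc n) = jtms n ++ (jv n ∷ (cartesianProductWith _⊕_ (jtms n) (jtms n) ++ cartesianProductWith m (ptms n) (jtms n)))

module JTms = IncreasingChain jtms (λ n → ∈-++⁺ˡ)

jtms-covers : ∀ t → ∃ λ n → t ∈ jtms n
jtms-covers (jv i) = suc i , ∈-++⁺ʳ (jtms i) (here refl)
jtms-covers (t ⊕ s) with jtms-covers t | jtms-covers s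
... | a , t∈ | b , s∈ = suc (a ⊔ b) , ∈-++⁺ʳ (jtms (a ⊔ b)) (there (∈-++⁺ˡ
      (∈-cartesianProductWith⁺ _⊕_ (JTms.mono-⊔ˡ a b t∈) (JTms.mono-⊔ʳ a b s∈))))
jtms-covers (m l t) with ptms-covers l | jtms-covers t
... | a , l∈ | b , t∈ = suc (a ⊔ b) , ∈-++⁺ʳ (jtms (a ⊔ b)) (there
      (∈-++⁺ʳ (cartesianProductWith _⊕_ (jtms (a ⊔ b)) (jtms (a ⊔ b)))
      (∈-cartesianProductWith⁺ m (PTms.mono-⊔ˡ a b l∈) (JTms.mono-⊔ʳ a b t∈))))

fms : ℕ → List Fm
fms zero    = []
fms (suc n) = fms n ++ (atom n ∷ ⊥' ∷ (cartesianProductWith _⇒_ (fms n) (fms n)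
  ++ (cartesianProductWith _∶_ (ptms n) (fms n) ++ cartesianProductWith [_]_ (jtms n) (fms n))))

module Fms = IncreasingChain fms (λ n → ∈-++⁺ˡ)

fms-covers : ∀ F → ∃ λ n → F ∈ fms n
fms-covers (atom i) = suc i , ∈-++⁺ʳ (fms i) (here refl)
fms-covers ⊥'       = 1 , there (here refl)
fms-covers (F ⇒ G) with fms-covers F | fms-covers G
... | a , F∈ | b , G∈ = suc (a ⊔ b) , ∈-++⁺ʳ (fms (a ⊔ b)) (there (there (∈-++⁺ˡ
      (∈-cartesianProductWith⁺ _⇒_ (Fms.mono-⊔ˡ a b F∈) (Fms.mono-⊔ʳ a b G∈)))))
fms-covers (l ∶ F) with ptms-covers l | fms-covers F
... | a , l∈ | b , F∈ = suc (a ⊔ b) , ∈-++⁺ʳ (fms (a ⊔ b)) (there (there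
      (∈-++⁺ʳ (cartesianProductWith _⇒_ (fms (a ⊔ b)) (fms (a ⊔ b))) (∈-++⁺ˡ
      (∈-cartesianProductWith⁺ _∶_ (PTms.mono-⊔ˡ a b l∈) (Fms.mono-⊔ʳ a b F∈))))))
fms-covers ([ t ] F) with jtms-covers t | fms-covers F
... | a , t∈ | b , F∈ = suc (a ⊔ b) , ∈-++⁺ʳ (fms (a ⊔ b)) (there (there
      (∈-++⁺ʳ (cartesianProductWith _⇒_ (fms (a ⊔ b)) (fms (a ⊔ b)))
      (∈-++⁺ʳ (cartesianProductWith _∶_ (ptms (a ⊔ b)) (fms (a ⊔ b)))
      (∈-cartesianProductWith⁺ [_]_ (JTms.mono-⊔ˡ a b t∈) (Fms.mono-⊔ʳ a b F∈))))))

-- Lindenbaum's lemma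

module Lindenbaum (em : ExcludedMiddle 0ℓ) (CS : ConstSpec)
                  (seed : List Fm) (seed-consistent : Derivations.Consistent CS seed) where
  open Derivations CS

  extend : (Δ : List Fm) (G : Fm) → Dec (Consistent (Δ ∷ʳ G)) → List Fm
  extend Δ G (yes _) = Δ ∷ʳ G
  extend Δ G (no _)  = Δ

  extend-⊇ : ∀ {Δ G} d → Δ ⊆ extend Δ G d
  extend-⊇ (yes _) = ∈-++⁺ˡ
  extend-⊇ (no _)  = λ x∈ → x∈

  extend-consistent : ∀ {Δ G} d → Consistent Δ → Consistent (extend Δ G d)
  extend-consistent (yes c) _ = c
  extend-consistent (no _)  c = c

  extend-decides : ∀ Δ G d → G ∈ extend Δ G d ⊎ Δ ⊢* ¬' G
  extend-decides Δ G (yes _)  = inj₁ (∈-++⁺ʳ Δ (here refl))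
  extend-decides Δ G (no ¬c) = inj₂ (deduction (em⇒dne em ¬c))

  extend* : List Fm → List Fm → List Fm
  extend* Δ []       = Δ
  extend* Δ (G ∷ Gs) = extend* (extend Δ G em) Gs

  extend*-⊇ : ∀ Δ Gs → Δ ⊆ extend* Δ Gs
  extend*-⊇ Δ []       = λ x∈ → x∈
  extend*-⊇ Δ (G ∷ Gs) = λ x∈ → extend*-⊇ (extend Δ G em) Gs (extend-⊇ em x∈)

  extend*-consistent : ∀ Δ Gs → Consistent Δ → Consistent (extend* Δ Gs)
  extend*-consistent Δ []       c = c
  extend*-consistent Δ (G ∷ Gs) c = extend*-consistent (extend Δ G em) Gs (extend-consistent em c)

  extend*-decides : ∀ Δ Gs → G ∈ Gs → G ∈ extend* Δ Gs ⊎ extend* Δ Gs ⊢* ¬' G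
  extend*-decides Δ (G ∷ Gs) (here refl) with extend-decides Δ G em
  ... | inj₁ G∈ = inj₁ (extend*-⊇ (extend Δ G em) Gs G∈)
  ... | inj₂ d  = inj₂ (⊢*-weaken (λ x∈ → extend*-⊇ (extend Δ G em) Gs (extend-⊇ em x∈)) d)
  extend*-decides Δ (_ ∷ Gs) (there G∈) = extend*-decides _ Gs G∈

  stage : ℕ → List Fm
  stage zero    = seed
  stage (suc n) = extend* (stage n) (fms n)

  open IncreasingChain stage (λ n → extend*-⊇ (stage n) (fms n))

  stage-consistent : ∀ n → Consistent (stage n)
  stage-consistent zero    = seed-consistent
  stage-consistent (suc n) = extend*-consistent (stage n) (fms n) (stage-consistent n)

  stage-decides : ∀ G → ∃ λ n → G ∈ stage n ⊎ stage n ⊢* ¬' G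
  stage-decides G with fms-covers G
  ... | n , G∈ = suc n , extend*-decides (stage n) (fms n) G∈

  Limit : Fm → Set
  Limit G = ∃ λ n → G ∈ stage n

  stage⊆Limit : ∀ n → All Limit (stage n)
  stage⊆Limit n = All.tabulate (n ,_)

  limit-⊥ : ¬ Limit ⊥'
  limit-⊥ (n , ⊥∈) = stage-consistent n (⊢*-assumption ⊥∈)

  limit-closed : All Limit L → L ⊢* G → Limit G
  -- G is decided at some stage n; were it refuted there, a later stage would derive ⊥.
  limit-closed {L} {G} L⊆ d with stage-decides G
  ... | n , inj₁ G∈ = n , G∈
  ... | n , inj₂ ¬G with bound L⊆
  ...   | k , L⊆stage = ⊥-elim (stage-consistent (n ⊔ k)
          (⊢*-mp (⊢*-weaken (mono-⊔ˡ n k) ¬G) (⊢*-weaken (λ x∈ → mono-⊔ʳ n k (L⊆stage x∈)) d)))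

  limit : MaxConsistent CS
  limit = record
    { mem        = λ G → does (em {Limit G})
    ; ⊢⇒∈        = λ d → dec-true em (limit-closed [] (mk⊢* d))
    ; ∈-mp       = λ A⇒B∈ A∈ → dec-true em (limit-closed (witness em A⇒B∈ ∷ witness em A∈ ∷ [])
                     (⊢*-mp (⊢*-assumption (here refl)) (⊢*-assumption (there (here refl)))))
    ; ⊥∉         = λ ⊥∈ → limit-⊥ (witness em ⊥∈)
    ; ∈-complete = complete
    }
    where
    complete : ∀ A → does (em {Limit A}) ≡ true ⊎ does (em {Limit (¬' A)}) ≡ true
    complete A with stage-decides A
    ... | n , inj₁ A∈ = inj₁ (dec-true em (n , A∈))
    ... | n , inj₂ ¬A = inj₂ (dec-true em (limit-closed (stage⊆Limit n) ¬A))

  seed⊆limit : All (_∈ᵇ mem limit) seed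
  seed⊆limit = All.map (dec-true em) (stage⊆Limit 0)

module _ (em : ExcludedMiddle 0ℓ) {CS : ConstSpec} where
  open Derivations CS

  lindenbaum : Consistent L → Σ (MaxConsistent CS) λ w → All (_∈ᵇ mem w) L
  lindenbaum {L} c = limit , seed⊆limit
    where open Lindenbaum em CS L c

  ⊢*-complete : (∀ (w : MaxConsistent CS) → All (_∈ᵇ mem w) L → G ∈ᵇ mem w) → L ⊢* G
  ⊢*-complete {L} {G} entails = em⇒dne em λ ¬d → refute (lindenbaum (consistent ¬d))
    where
    consistent : ¬ (L ⊢* G) → Consistent (L ∷ʳ ¬' G)
    consistent ¬d d = ¬d (⊢*-taut (dne-taut G) (deduction d))

    refute : ¬ (Σ (MaxConsistent CS) λ w → All (_∈ᵇ mem w) (L ∷ʳ ¬' G))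
    refute (w , ∈w) with ∷ʳ⁻ ∈w
    ... | L∈ , ¬G∈ = ⊥∉ w (∈-mp w ¬G∈ (entails w L∈))

-- The canonical model

module _ {CS : ConstSpec} where
  open Derivations CS

  ∈-[]-⊢⇒ : AxiomaticallyAppropriate CS → (w : MaxConsistent CS) →
            CS ⊢ (G ⇒ F) → ([ t ] G) ∈ᵇ mem w → ∃ λ s → ([ s ] F) ∈ᵇ mem w
  ∈-[]-⊢⇒ {G} {F} {t} AA w G⇒F tG∈ with internalization AA G⇒F
  ... | l , ⊢l = m l t , ∈-⊢⇒⇒ w (axm (ax-jm l t G F)) (⊢⇒∈ w ⊢l) tG∈

  canonicalEval : MaxConsistent CS → BasicEval CS
  canonicalEval w = record
    { val   = λ p → mem w (atom p)
    ; εp    = λ l F → mem w (l ∶ F)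
    ; εj    = λ t F → mem w ([ t ] F)
    ; app   = λ l k F G → ∈-⊢⇒⇒ w (axm (ax-j l k G F))
    ; cs    = λ i F c → ⊢⇒∈ w (an c)
    ; bang  = λ l F → ∈-⊢⇒ w (axm (ax-j4 l F))
    ; mj    = λ l t F G → ∈-⊢⇒⇒ w (axm (ax-jm l t G F))
    ; plusˡ = λ t s F tF → ∈-⊢⇒ w (axm (ax-j+ t s F))
                (∈-⊢⇒ w (axm (ax-taut (∨'-introˡ-taut ([ t ] F) ([ s ] F)))) tF)
    ; plusʳ = λ t s F sF → ∈-⊢⇒ w (axm (ax-j+ t s F))
                (∈-⊢⇒ w (axm (ax-taut (weakening-taut ([ s ] F) (¬' ([ t ] F))))) sF)
    }

  canonical : MaxConsistent CS → QuasiModel CS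
  canonical w₀ = record
    { W    = MaxConsistent CS
    ; w₀   = w₀
    ; N    = λ w X → ∃₂ λ t G → ([ t ] G) ∈ᵇ mem w × (λ w′ → mem w′ G) ⊆ʷ X
    ; mono = λ { w X Y (t , G , tG∈ , |G|⊆X) X⊆Y → t , G , tG∈ , λ w′ G∈ → X⊆Y w′ (|G|⊆X w′ G∈) }
    ; ε    = canonicalEval
    }

  truth : ∀ w₀ w F → sat (canonical w₀) w F ≡ mem w F
  truth w₀ w (atom p)  = refl
  truth w₀ w ⊥'        = sym (¬-not (⊥∉ w))
  truth w₀ w (F ⇒ G)   =
    trans (cong₂ (λ a b → not a ∨ b) (truth w₀ w F) (truth w₀ w G)) (sym (mem-⇒ w F G))
  truth w₀ w (l ∶ F)   = refl
  truth w₀ w ([ t ] F) = refl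

  canonical-modular : ∀ w₀ → ModularModel CS (canonical w₀)
  canonical-modular w₀ = factive , justified
    where
    factive : Factive (canonical w₀)
    factive w l F l∶F∈ = trans (truth w₀ w F) (∈-⊢⇒ w (axm (ax-jt l F)) l∶F∈)
    justified : JustNbhd (canonical w₀)
    justified t w F tF∈ = t , F , tF∈ , λ w′ F∈ → trans (truth w₀ w′ F) F∈

  canonical-fullyExplanatory : ExcludedMiddle 0ℓ → AxiomaticallyAppropriate CS →
                               ∀ w₀ → FullyExplanatory (canonical w₀)
  canonical-fullyExplanatory em AA w₀ w F (t , G , tG∈ , |G|⊆|F|) = ∈-[]-⊢⇒ AA w G⇒F tG∈
    where
    G⇒F : CS ⊢ (G ⇒ F)
    G⇒F = ⇒*-derivable (⊢*-complete em {L = G ∷ []} λ { w′ (G∈ ∷ []) →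
      trans (sym (truth w₀ w′ F)) (|G|⊆|F| w′ G∈) })

  completeness : ExcludedMiddle 0ℓ → AxiomaticallyAppropriate CS → ∀ F →
    ((M : QuasiModel CS) → ModularModel CS M → FullyExplanatory M → Valid M F) → CS ⊢ F
  completeness em AA F valid = ⇒*-derivable (⊢*-complete em {L = []} λ w _ →
    trans (sym (truth w w F)) (valid (canonical w) (canonical-modular w) (canonical-fullyExplanatory em AA w) w))

mainTheorem6 : ExcludedMiddle 0ℓ →
    (CS : ConstSpec) → AxiomaticallyAppropriate CS →
    (F : Fm) →
    ((CS ⊢ F) → ((M : QuasiModel CS) → ModularModel CS M → FullyExplanatory M → Valid M F))
    × (((M : QuasiModel CS) → ModularModel CS M → FullyExplanatory M → Valid M F) → (CS ⊢ F))
mainTheorem6 em CS AA F = (λ ⊢F M (factive , _) _ → soundness M factive ⊢F) , completeness em AA F
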